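{- In Cantor space, let $A,B\subseteq\{0,1\}^*$ with $A\lhd B$. Then for every $a\in A$ there is a finite $C\subseteq B$ such that $\{a\}\lhd C$.
   Context: Setting: Bishop-style constructive mathematics. Cantor space has as set of basic dots $\{0,1\}^*$ (finite binary sequences), with $b\preccurlyeq a$ iff $b$ extends $a$ ($b=a\star c$), $b\prec a$ iff $b\preccurlyeq a$ and $b\ne a$, and $a\#b$ iff neither of $a,b$ extends the other. For a natural space with set of basic dots $V$, the formal inductive covering relation $\lhd$ between subsets of $V$ is defined inductively as the least relation satisfying: (1) $b\preccurlyeq c$ implies $\{b\}\lhd\{c\}$; (2) if $\{a\}\lhd B$ for all $a\in A$ then $A\lhd B$; (3) if $A\lhd B$ and $B\subseteq C$ then $A\lhd C$; (4) if $A\lhd B$ and $B\lhd C$ then $A\lhd C$; (5) $\{b\}\lhd\{d: d\prec b\}$ for each $b$. The corresponding induction principle is assumed: any property of pairs $(A,B)$ closed under rules (1)–(5) holds for all $A\lhd B$. -}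

module Defs where

open import Level using (0ℓ)
open import Data.Bool using (Bool)
open import Data.List using (List; _++_)
open import Data.List.Membership.Propositional using (_∈_)
open import Data.Product using (∃; _×_)
open import Relation.Binary.PropositionalEquality using (_≡_; _≢_)
open import Relation.Unary using (Pred; _⊆_)

Dot : Set
Dot = List Bool

Subset : Set₁
Subset = Pred Dot 0ℓ

_≼_ : Dot → Dot → Set
b ≼ a = ∃ λ c → b ≡ a ++ c

_≺_ : Dot → Dot → Set
b ≺ a = (b ≼ a) × (b ≢ a)

⟦_⟧ : Dot → Subset
⟦ b ⟧ x = x ≡ b

below : Dot → Subset
below b d = d ≺ b

data _◁_ : Subset → Subset → Set₁ where
  refl≼ : ∀ {b c} → b ≼ c → ⟦ b ⟧ ◁ ⟦ c ⟧
  union : ∀ {A B} → (∀ a → A a → ⟦ a ⟧ ◁ B) → A ◁ B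
  mono  : ∀ {A B C} → A ◁ B → B ⊆ C → A ◁ C
  trans : ∀ {A B C} → A ◁ B → B ◁ C → A ◁ C
  split : ∀ b → ⟦ b ⟧ ◁ below b

listSubset : List Dot → Subset
listSubset cs x = x ∈ cs

-- Finite covers pass through every rule;
-- for transitivity, each of the finitely many dots of the intermediate cover is
-- covered finitely and the covers are concatenated. The split rule is the only
-- one producing an infinite cover {d : d ≺ b}, but that set is itself covered
-- by the two immediate extensions b0 and b1 of b.
module Submission where

open import Defs
open import Data.Bool using (false; true)
open import Data.Empty using (⊥-elim)
open import Data.List using (List; []; _∷_; _++_; [_])
open import Data.List.Membership.Propositional using (_∈_)
open import Data.List.Membership.Propositional.Properties using (∈-++⁺ˡ; ∈-++⁺ʳ)
open import Data.List.Properties using (++-assoc; ++-identityʳ; ++-identityʳ-unique)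
open import Data.List.Relation.Unary.All as All using (All; []; _∷_)
open import Data.List.Relation.Unary.All.Properties using (++⁺)
open import Data.List.Relation.Unary.Any using (here; there)
open import Data.Product using (∃; _×_; _,_)
open import Function using (case_of_)
open import Relation.Binary.PropositionalEquality as ≡ using (refl)

FinitelyCovered : Subset → Dot → Set₁
FinitelyCovered B a = ∃ λ (cs : List Dot) → All B cs × (⟦ a ⟧ ◁ listSubset cs)

◁-∈ : ∀ {c cs} → c ∈ cs → ⟦ c ⟧ ◁ listSubset cs
◁-∈ {c} c∈cs = mono (refl≼ ([] , ≡.sym (++-identityʳ c))) (λ { refl → c∈cs })

◁-finite-transitive : ∀ {B C : Subset} (bs : List Dot) → All B bs →
  (∀ b → B b → FinitelyCovered C b) →
  ∃ λ (cs : List Dot) → All C cs × (listSubset bs ◁ listSubset cs)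
◁-finite-transitive [] [] covered = [] , [] , union (λ _ ())
◁-finite-transitive (b ∷ bs) (Bb ∷ Bbs) covered
  with covered b Bb | ◁-finite-transitive bs Bbs covered
... | cs₁ , Ccs₁ , b◁cs₁ | cs₂ , Ccs₂ , bs◁cs₂ = cs₁ ++ cs₂ , ++⁺ Ccs₁ Ccs₂ , union cover
  where
  cover : ∀ x → x ∈ b ∷ bs → ⟦ x ⟧ ◁ listSubset (cs₁ ++ cs₂)
  cover x (here refl) = mono b◁cs₁ ∈-++⁺ˡ
  cover x (there x∈bs) = mono (trans (◁-∈ x∈bs) bs◁cs₂) (∈-++⁺ʳ cs₁)

children : Dot → List Dot
children b = (b ++ [ false ]) ∷ (b ++ [ true ]) ∷ []

children-below : ∀ b → All (below b) (children b)
children-below b = child-below false ∷ child-below true ∷ []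
  where
  child-below : ∀ x → below b (b ++ [ x ])
  child-below x = ([ x ] , refl) , λ b[x]≡b → case ++-identityʳ-unique b (≡.sym b[x]≡b) of λ ()

below◁children : ∀ b → below b ◁ listSubset (children b)
below◁children b = union cover
  where
  cover : ∀ d → below b d → ⟦ d ⟧ ◁ listSubset (children b)
  cover d (([] , d≡b++[]) , d≢b) = ⊥-elim (d≢b (≡.trans d≡b++[] (++-identityʳ b)))
  cover d ((false ∷ c , d≡b0c) , _) =
    mono (refl≼ (c , ≡.trans d≡b0c (≡.sym (++-assoc b [ false ] c)))) (λ { refl → here refl })
  cover d ((true ∷ c , d≡b1c) , _) =
    mono (refl≼ (c , ≡.trans d≡b1c (≡.sym (++-assoc b [ true ] c)))) (λ { refl → there (here refl) })

split-finite : ∀ b → FinitelyCovered (below b) b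
split-finite b = children b , children-below b , trans (split b) (below◁children b)

◁⇒finitelyCovered : ∀ {A B : Subset} → A ◁ B → ∀ a → A a → FinitelyCovered B a
◁⇒finitelyCovered (refl≼ {c = c} b≼c) a refl =
  [ c ] , refl ∷ [] , trans (refl≼ b≼c) (◁-∈ (here refl))
◁⇒finitelyCovered (union A◁B) a Aa = ◁⇒finitelyCovered (A◁B a Aa) a refl
◁⇒finitelyCovered (mono A◁B B⊆C) a Aa with ◁⇒finitelyCovered A◁B a Aa
... | cs , Bcs , a◁cs = cs , All.map B⊆C Bcs , a◁cs
◁⇒finitelyCovered (trans A◁B B◁C) a Aa with ◁⇒finitelyCovered A◁B a Aa
... | bs , Bbs , a◁bs with ◁-finite-transitive bs Bbs (◁⇒finitelyCovered B◁C)
... | cs , Ccs , bs◁cs = cs , Ccs , trans a◁bs bs◁cs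
◁⇒finitelyCovered (split b) a refl = split-finite b

mainTheorem9 : (A B : Subset) → A ◁ B → ∀ a → A a →
    ∃ λ (cs : List Dot) → All B cs × (⟦ a ⟧ ◁ listSubset cs)
mainTheorem9 A B = ◁⇒finitelyCovered
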